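{- Let $k\geq 3$ be an integer. For $n\geq 0$ let $r_n^{(k)}$ be the number of binary strings of length $n$ that start with $0$, end with $1$, and contain neither $k$ consecutive $0$'s nor $k$ consecutive $1$'s, with $r_0^{(k)}=1$. Let $d_n^{(k)}=1$ if $n\equiv 0\pmod k$, $d_n^{(k)}=-1$ if $n\equiv 1\pmod k$, and $d_n^{(k)}=0$ otherwise. Let the $(k-1)$-generalized Fibonacci numbers be defined by $f_n^{(k-1)}=2^n$ for $0\le n\le k-2$ and $f_n^{(k-1)}=f_{n-1}^{(k-1)}+\dots+f_{n-k+1}^{(k-1)}$ for $n\ge k-1$. Then $$r_n^{(k)}=\begin{cases}1 & n=0,\\[2pt] \dfrac{f_{n-1}^{(k-1)}+d_n^{(k)}}{2} & n\geq 1.\end{cases}$$ -}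

module Defs where

open import Data.Nat using (ℕ; zero; suc; _+_; _∸_; _^_; _≤ᵇ_; _%_; _≡ᵇ_)
open import Data.Bool using (Bool; true; false; if_then_else_; _∧_; not)
open import Data.List using (List; []; _∷_; take; filterᵇ; length; map; _++_)
open import Data.Vec using (Vec; []; _∷_; head; last)
open import Data.Nat.ListAction using (sum)
open import Data.Integer using (ℤ; +_; -_)

-- all binary strings of length n (false = 0, true = 1)
allStrings : (n : ℕ) → List (Vec Bool n)
allStrings zero = [] ∷ []
allStrings (suc n) = map (false ∷_) (allStrings n) ++ map (true ∷_) (allStrings n)

-- run-tracking check: no run of k equal consecutive symbols.
-- noRun k b c xs : the previous symbol was b, with c consecutive copies of b ending there.
noRunFrom : ℕ → Bool → ℕ → {n : ℕ} → Vec Bool n → Bool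
noRunFrom k b c [] = true
noRunFrom k b c (x ∷ xs) =
  if x == b then not (k ≤ᵇ suc c) ∧ noRunFrom k b (suc c) xs
            else not (k ≤ᵇ 1) ∧ noRunFrom k x 1 xs
  where
  _==_ : Bool → Bool → Bool
  true == true = true
  false == false = true
  _ == _ = false

noKRun : (k : ℕ) → {n : ℕ} → Vec Bool n → Bool
noKRun k [] = true
noKRun k (x ∷ xs) = not (k ≤ᵇ 1) ∧ noRunFrom k x 1 xs

good : (k : ℕ) → {n : ℕ} → Vec Bool n → Bool
good k [] = false
good k (x ∷ xs) = not x ∧ last (x ∷ xs) ∧ noKRun k (x ∷ xs)

r : ℕ → ℕ → ℕ
r k zero = 1
r k (suc n) = length (filterᵇ (good k) (allStrings (suc n)))

d : ℕ → ℕ → ℤ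
d zero n = + 0
d (suc k) n with n % suc k
... | 0 = + 1
... | 1 = - (+ 1)
... | _ = + 0

-- fibVals k n = [f_n, f_{n-1}, ..., f_0] for the (k-1)-generalized Fibonacci numbers
fibVals : ℕ → ℕ → List ℕ
fibVals k zero = 1 ∷ []
fibVals k (suc n) =
  (if suc n ≤ᵇ k ∸ 2 then 2 ^ suc n else sum (take (k ∸ 1) (fibVals k n))) ∷ fibVals k n

fib : ℕ → ℕ → ℕ
fib k n with fibVals k n
... | [] = 0
... | x ∷ _ = x

module Submission where

-- The argument works for every k ≥ 2 (the statement asks for k ≥ 3).  Reading a
-- string from left to right, the only information needed to decide whether it may
-- be continued is the state (b , c): the last symbol b and the length c of the run
-- of b's ending there.  Let ways n b c be the number
-- of continuations of length n from state (b , c) that never complete a k-run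
-- and end in 1.  Then r (n+1) = ways n 0 1, and ways obeys a one-step recurrence.
--
-- Two combinations of ways decouple the recurrence:
--   * the total  S n c = ways n 1 c + ways n 0 c  (continuations ending in either
--     symbol) satisfies the (k-1)-bonacci recurrence, so S n 1 = f_n;
--   * the difference  D n c = ways n 1 c - ways n 0 c  has the closed form
--     D n c = δ n - δ (c + n), where δ x = [k ∣ x]; hence -D n 1 = d_{n+1}.
-- Consequently 2 r (n+1) = S n 1 - D n 1 = f_n + d_{n+1}.

open import Defs
open import Data.Nat using (ℕ; zero; suc; _≤_; s≤s)
open import Data.Nat.ListAction using (sum)
open import Data.Bool using (Bool; true; false; if_then_else_; _∧_; not)
open import Data.List using (List; []; _∷_; take; filterᵇ; length; map; _++_)
open import Data.Vec using (Vec; _∷_; last)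
open import Data.Product using (_×_; _,_)
open import Relation.Binary.PropositionalEquality
  using (_≡_; refl; sym; trans; cong; cong₂; module ≡-Reasoning)

open ≡-Reasoning

module Counting where

  open import Data.Nat using (_+_; _≤ᵇ_; _<_)
  open import Data.Nat.Properties using (≤⇒≤ᵇ; ≤ᵇ-reflects-≤; <⇒≱)
  open import Data.Bool.Properties using (∧-zeroʳ; T-≡)
  open import Data.List.Properties using (length-++; filter-++)
  open import Function.Bundles using (Equivalence)
  open import Relation.Nullary using (contradiction; ofʸ)

  count : {A : Set} → (A → Bool) → List A → ℕ
  count P xs = length (filterᵇ P xs)

  count-++ : {A : Set} (P : A → Bool) (xs ys : List A) → count P (xs ++ ys) ≡ count P xs + count P ys
  count-++ P xs ys = trans (cong length (filter-++ _ xs ys)) (length-++ (filterᵇ P xs))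

  count-map : {A B : Set} (P : B → Bool) (f : A → B) (xs : List A) → count P (map f xs) ≡ count (λ x → P (f x)) xs
  count-map P f [] = refl
  count-map P f (x ∷ xs) with P (f x)
  ... | true  = cong suc (count-map P f xs)
  ... | false = count-map P f xs

  count-none : {A : Set} (P : A → Bool) → (∀ x → P x ≡ false) → (xs : List A) → count P xs ≡ 0
  count-none P none [] = refl
  count-none P none (x ∷ xs) rewrite none x = count-none P none xs

  count-guard : {A : Set} (g : Bool) (P Q : A → Bool) (xs : List A) →
    count (λ x → P x ∧ (g ∧ Q x)) xs ≡ (if g then count (λ x → P x ∧ Q x) xs else 0)
  count-guard true  P Q xs = refl
  count-guard false P Q xs = count-none _ (λ x → ∧-zeroʳ (P x)) xs

  count-allStrings : ∀ n (P : Vec Bool (suc n) → Bool) →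
    count P (allStrings (suc n)) ≡ count (λ xs → P (false ∷ xs)) (allStrings n) + count (λ xs → P (true ∷ xs)) (allStrings n)
  count-allStrings n P = trans (count-++ P (map (false ∷_) (allStrings n)) _)
    (cong₂ _+_ (count-map P (false ∷_) (allStrings n)) (count-map P (true ∷_) (allStrings n)))

  ≤⇒≤ᵇ≡true : ∀ {m n} → m ≤ n → (m ≤ᵇ n) ≡ true
  ≤⇒≤ᵇ≡true m≤n = Equivalence.to T-≡ (≤⇒≤ᵇ m≤n)

  >⇒≤ᵇ≡false : ∀ {m n} → n < m → (m ≤ᵇ n) ≡ false
  >⇒≤ᵇ≡false {m} {n} n<m with m ≤ᵇ n | ≤ᵇ-reflects-≤ m n
  ... | false | _       = refl
  ... | true  | ofʸ m≤n = contradiction m≤n (<⇒≱ n<m)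

  take-++-prefix : {A : Set} (m : ℕ) (xs ys : List A) → m ≤ length xs → take m (xs ++ ys) ≡ take m xs
  take-++-prefix zero    xs       ys _         = refl
  take-++-prefix (suc m) (x ∷ xs) ys (s≤s m≤n) = cong (x ∷_) (take-++-prefix m xs ys m≤n)

open Counting

-- Throughout, k = k₀ + 2 ≥ 2 is the forbidden run length.
module Runs (k₀ : ℕ) where

  open import Data.Nat using (_+_; _*_; _∸_; _^_; _≤ᵇ_; _%_; _/_; _<_; z≤n; _≤?_)
  open import Data.Nat.Properties
    using (+-comm; +-assoc; +-identityʳ; +-suc; m+n∸n≡m; ≰⇒>; ≤-refl; ≤-trans; n≤1+n; m≤n⇒m<n∨m≡n; +-∸-assoc; suc-injective)
  open import Data.Nat.DivMod using (m≡m%n+[m/n]*n; m*n%n≡0; [m+kn]%n≡m%n; [m+n]%n≡m%n; m<n⇒m%n≡m)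
  open import Data.Nat.ListAction.Properties using (sum-++)
  open import Data.List.Properties using (take-all; take-[]; length-++)
  open import Data.Integer using (ℤ; +_; -_; _-_) renaming (_+_ to _+ℤ_; _*_ to _*ℤ_)
  open import Data.Integer.Properties using (pos-+)
  open import Data.Integer.Tactic.RingSolver using (solve-∀)
  import Data.Nat.Tactic.RingSolver as ℕ-Ring
  open import Data.Sum using (inj₁; inj₂)
  open import Relation.Nullary using (yes; no; contradiction)

  sums-interchange : ∀ (a b x y : ℕ) → (a + b) + (x + y) ≡ (a + x) + (y + b)
  sums-interchange = ℕ-Ring.solve-∀

  sums-difference : ∀ (a b x y : ℤ) → (a +ℤ b) - (x +ℤ y) ≡ (a - x) - (y - b)
  sums-difference = solve-∀

  swap-difference : ∀ (a b : ℤ) → b - a ≡ - (a - b)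
  swap-difference = solve-∀

  twice-from-sum-and-difference : ∀ (s t : ℤ) → + 2 *ℤ t ≡ (s +ℤ t) +ℤ - (s - t)
  twice-from-sum-and-difference = solve-∀

  k : ℕ
  k = suc (suc k₀)

  -- Runs of length 1 are always allowed.
  1<k : 1 < k
  1<k = s≤s (s≤s z≤n)

  extendable : ℕ → Bool
  extendable c = not (k ≤ᵇ suc c)

  accepted : Bool → ℕ → {n : ℕ} → Vec Bool n → Bool
  accepted b c xs = last (b ∷ xs) ∧ noRunFrom k b c xs

  -- The number of accepted continuations of length n, by the state recurrence:
  -- the next symbol either extends the current run or starts a new run of length 1.
  ways : ℕ → Bool → ℕ → ℕ
  ways zero    b c = if b then 1 else 0
  ways (suc n) b c = (if extendable c then ways n b (suc c) else 0) + ways n (not b) 1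

  count-accepted : ∀ n b c → count (accepted b c) (allStrings n) ≡ ways n b c
  count-accepted zero    false c = refl
  count-accepted zero    true  c = refl
  count-accepted (suc n) false c = begin
    count (accepted false c) (allStrings (suc n))
      ≡⟨ count-allStrings n (accepted false c) ⟩
    count (λ xs → last (false ∷ xs) ∧ (extendable c ∧ noRunFrom k false (suc c) xs)) (allStrings n)
      + count (accepted true 1) (allStrings n)
      ≡⟨ cong₂ _+_ (count-guard (extendable c) (λ xs → last (false ∷ xs)) (noRunFrom k false (suc c)) (allStrings n))
                   (count-accepted n true 1) ⟩
    (if extendable c then count (accepted false (suc c)) (allStrings n) else 0) + ways n true 1
      ≡⟨ cong (λ t → (if extendable c then t else 0) + ways n true 1) (count-accepted n false (suc c)) ⟩
    ways (suc n) false c ∎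
  count-accepted (suc n) true c = begin
    count (accepted true c) (allStrings (suc n))
      ≡⟨ count-allStrings n (accepted true c) ⟩
    count (accepted false 1) (allStrings n)
      + count (λ xs → last (true ∷ xs) ∧ (extendable c ∧ noRunFrom k true (suc c) xs)) (allStrings n)
      ≡⟨ +-comm (count (accepted false 1) (allStrings n)) _ ⟩
    count (λ xs → last (true ∷ xs) ∧ (extendable c ∧ noRunFrom k true (suc c) xs)) (allStrings n)
      + count (accepted false 1) (allStrings n)
      ≡⟨ cong₂ _+_ (count-guard (extendable c) (λ xs → last (true ∷ xs)) (noRunFrom k true (suc c)) (allStrings n))
                   (count-accepted n false 1) ⟩
    (if extendable c then count (accepted true (suc c)) (allStrings n) else 0) + ways n false 1
      ≡⟨ cong (λ t → (if extendable c then t else 0) + ways n false 1) (count-accepted n true (suc c)) ⟩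
    ways (suc n) true c ∎

  -- A good string of length n+1 is 0 followed by an accepted continuation from (0 , 1).
  r-ways : ∀ n → r k (suc n) ≡ ways n false 1
  r-ways n = begin
    r k (suc n)                                                  ≡⟨ count-allStrings n (good k) ⟩
    count (accepted false 1) (allStrings n) + count (λ _ → false) (allStrings n)
      ≡⟨ cong₂ _+_ (count-accepted n false 1) (count-none _ (λ _ → refl) (allStrings n)) ⟩
    ways n false 1 + 0                                           ≡⟨ +-identityʳ _ ⟩
    ways n false 1                                               ∎

  ways-full : ∀ n b c → k ≤ suc c → ways (suc n) b c ≡ ways n (not b) 1
  ways-full n b c k≤ rewrite ≤⇒≤ᵇ≡true k≤ = refl

  ways-open : ∀ n b c → suc c < k → ways (suc n) b c ≡ ways n b (suc c) + ways n (not b) 1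
  ways-open n b c <k rewrite >⇒≤ᵇ≡false <k = refl

  -- By the symmetry 0 ↔ 1, ways n false c also counts continuations from (1 , c)
  -- ending in 0, so S n c counts all run-free continuations from a run of length c.
  S : ℕ → ℕ → ℕ
  S n c = ways n true c + ways n false c

  -- S follows the (k-1)-bonacci recurrence in the second argument.
  S-full : ∀ n c → k ≤ suc c → S (suc n) c ≡ S n 1
  S-full n c k≤ rewrite ways-full n true c k≤ | ways-full n false c k≤ =
    +-comm (ways n false 1) (ways n true 1)

  S-open : ∀ n c → suc c < k → S (suc n) c ≡ S n (suc c) + S n 1
  S-open n c <k rewrite ways-open n true c <k | ways-open n false c <k =
    sums-interchange (ways n true (suc c)) (ways n false 1) (ways n false (suc c)) (ways n true 1)

  D : ℕ → ℕ → ℤ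
  D n c = + ways n true c - + ways n false c

  D-full : ∀ n c → k ≤ suc c → D (suc n) c ≡ - D n 1
  D-full n c k≤ rewrite ways-full n true c k≤ | ways-full n false c k≤ =
    swap-difference (+ ways n true 1) (+ ways n false 1)

  D-open : ∀ n c → suc c < k → D (suc n) c ≡ D n (suc c) - D n 1
  D-open n c <k rewrite ways-open n true c <k | ways-open n false c <k
    | pos-+ (ways n true (suc c)) (ways n false 1) | pos-+ (ways n false (suc c)) (ways n true 1) =
    sums-difference (+ ways n true (suc c)) (+ ways n false 1) (+ ways n false (suc c)) (+ ways n true 1)

  seeded : ℕ → List ℕ
  seeded zero    = 1 ∷ []
  seeded (suc n) = sum (take (k ∸ 1) (seeded n)) ∷ seeded n

  S-closed : ∀ n c → c < k → S n c ≡ sum (take (k ∸ c) (seeded n))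
  S-closed zero c (s≤s c≤) rewrite +-∸-assoc 1 c≤ = cong suc (sym (cong sum (take-[] (suc k₀ ∸ c))))
  S-closed (suc n) c (s≤s c≤) with m≤n⇒m<n∨m≡n (s≤s c≤)
  ... | inj₂ refl rewrite S-full n c (s≤s c≤) | m+n∸n≡m 1 (suc k₀) = begin
    S n 1                              ≡⟨ S-closed n 1 1<k ⟩
    sum (take (k ∸ 1) (seeded n))      ≡⟨ sym (+-identityʳ _) ⟩
    sum (take 1 (seeded (suc n)))      ∎
  ... | inj₁ <k rewrite S-open n c <k | +-∸-assoc 1 c≤ = begin
    S n (suc c) + S n 1
      ≡⟨ cong₂ _+_ (S-closed n (suc c) <k) (S-closed n 1 1<k) ⟩
    sum (take (k ∸ suc c) (seeded n)) + sum (take (k ∸ 1) (seeded n))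
      ≡⟨ +-comm (sum (take (k ∸ suc c) (seeded n))) _ ⟩
    sum (take (suc (k ∸ suc c)) (seeded (suc n))) ∎

  isZero : ℕ → ℤ
  isZero zero    = + 1
  isZero (suc _) = + 0

  δ : ℕ → ℤ
  δ x = isZero (x % k)

  δ-periodic : ∀ n → δ (k + n) ≡ δ n
  δ-periodic n = cong isZero (trans (cong (_% k) (+-comm k n)) ([m+n]%n≡m%n n k))

  δ-small : ∀ c → 0 < c → c < k → δ c ≡ + 0
  δ-small (suc c) _ c<k rewrite m<n⇒m%n≡m c<k = refl

  D-closed : ∀ n c → 0 < c → c < k → D n c ≡ δ n - δ (c + n)
  D-closed zero c 0<c c<k rewrite +-identityʳ c | δ-small c 0<c c<k = refl
  D-closed (suc n) c 0<c c<k with m≤n⇒m<n∨m≡n c<k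
  ... | inj₂ refl rewrite D-full n c ≤-refl = begin
    - D n 1                            ≡⟨ cong -_ (D-closed n 1 (s≤s z≤n) 1<k) ⟩
    - (δ n - δ (suc n))                ≡⟨ sym (swap-difference (δ n) (δ (suc n))) ⟩
    δ (suc n) - δ n                    ≡⟨ cong (λ t → δ (suc n) - t) (sym (δ-periodic n)) ⟩
    δ (suc n) - δ (k + n)              ≡⟨ cong (λ t → δ (suc n) - δ t) (sym (+-suc c n)) ⟩
    δ (suc n) - δ (c + suc n)          ∎
  ... | inj₁ <k rewrite D-open n c <k = begin
    D n (suc c) - D n 1
      ≡⟨ cong₂ _-_ (D-closed n (suc c) (s≤s z≤n) <k) (D-closed n 1 (s≤s z≤n) 1<k) ⟩
    (δ n - δ (suc (c + n))) - (δ n - δ (suc n))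
      ≡⟨ cancel (δ n) (δ (suc (c + n))) (δ (suc n)) ⟩
    δ (suc n) - δ (suc (c + n))
      ≡⟨ cong (λ t → δ (suc n) - δ t) (sym (+-suc c n)) ⟩
    δ (suc n) - δ (c + suc n) ∎
    where
    cancel : ∀ (a b e : ℤ) → (a - b) - (a - e) ≡ e - b
    cancel = solve-∀

  -- n ≡ 0 (mod k) exactly when n+1 ≡ 1 (mod k); this uses k ≥ 2.
  divisible⇒next-mod-one : ∀ n → n % k ≡ 0 → suc n % k ≡ 1
  divisible⇒next-mod-one n n%k≡0 = begin
    suc n % k                      ≡⟨ cong (λ t → suc t % k) (m≡m%n+[m/n]*n n k) ⟩
    (1 + (n % k + (n / k) * k)) % k ≡⟨ cong (λ t → (1 + (t + (n / k) * k)) % k) n%k≡0 ⟩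
    (1 + (n / k) * k) % k          ≡⟨ [m+kn]%n≡m%n 1 (n / k) k ⟩
    1                              ∎

  next-mod-one⇒divisible : ∀ n → suc n % k ≡ 1 → n % k ≡ 0
  next-mod-one⇒divisible n eq = begin
    n % k                       ≡⟨ cong (_% k) (suc-injective n-as-multiple) ⟩
    ((suc n / k) * k) % k       ≡⟨ m*n%n≡0 (suc n / k) k ⟩
    0                           ∎
    where
    n-as-multiple : suc n ≡ 1 + (suc n / k) * k
    n-as-multiple = trans (m≡m%n+[m/n]*n (suc n) k) (cong (λ t → t + (suc n / k) * k) eq)

  d-as-δ : ∀ n → d k (suc n) ≡ δ (suc n) - δ n
  d-as-δ n with suc n % k in eq | n % k in eq′
  ... | 0           | 0     = contradiction (trans (sym eq) (divisible⇒next-mod-one n eq′)) λ ()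
  ... | 0           | suc _ = refl
  ... | 1           | 0     = refl
  ... | 1           | suc _ = contradiction (trans (sym eq′) (next-mod-one⇒divisible n eq)) λ ()
  ... | suc (suc _) | 0     = contradiction (trans (sym eq) (divisible⇒next-mod-one n eq′)) λ ()
  ... | suc (suc _) | suc _ = refl

  fibVals-geometric : ∀ m → m ≤ k ∸ 2 → sum (fibVals k m) + 1 ≡ 2 ^ suc m
  fibVals-geometric zero    _    = refl
  fibVals-geometric (suc m) m<k rewrite ≤⇒≤ᵇ≡true m<k = begin
    (2 ^ suc m + sum (fibVals k m)) + 1 ≡⟨ +-assoc (2 ^ suc m) _ 1 ⟩
    2 ^ suc m + (sum (fibVals k m) + 1) ≡⟨ cong (λ t → 2 ^ suc m + t) (fibVals-geometric m (≤-trans (n≤1+n m) m<k)) ⟩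
    2 ^ suc m + 2 ^ suc m               ≡⟨ cong (λ t → 2 ^ suc m + t) (sym (+-identityʳ _)) ⟩
    2 ^ suc (suc m)                     ∎

  length-fibVals : ∀ n → length (fibVals k n) ≡ suc n
  length-fibVals zero    = refl
  length-fibVals (suc n) = cong suc (length-fibVals n)

  -- Both branches of the definition of f_{m+1} are the (k-1)-term window sum
  -- of the list [f_m, …, f_0] extended by the seed f_{-1} = 1.
  fib-window : ∀ m → fib k (suc m) ≡ sum (take (k ∸ 1) (fibVals k m ++ 1 ∷ []))
  fib-window m with suc m ≤? k ∸ 2
  ... | yes m<k rewrite ≤⇒≤ᵇ≡true m<k = sym (begin
    sum (take (k ∸ 1) (fibVals k m ++ 1 ∷ [])) ≡⟨ cong sum (take-all (k ∸ 1) (fibVals k m ++ 1 ∷ []) short) ⟩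
    sum (fibVals k m ++ 1 ∷ [])                ≡⟨ sum-++ (fibVals k m) (1 ∷ []) ⟩
    sum (fibVals k m) + 1                      ≡⟨ fibVals-geometric m (≤-trans (n≤1+n m) m<k) ⟩
    2 ^ suc m                                  ∎)
    where
    short : length (fibVals k m ++ 1 ∷ []) ≤ k ∸ 1
    short rewrite length-++ (fibVals k m) {1 ∷ []} | length-fibVals m | +-comm m 1 = s≤s m<k
  ... | no m≮k rewrite >⇒≤ᵇ≡false (≰⇒> m≮k) =
    sym (cong sum (take-++-prefix (k ∸ 1) (fibVals k m) _ long))
    where
    long : k ∸ 1 ≤ length (fibVals k m)
    long rewrite length-fibVals m = ≰⇒> m≮k

  fibVals-seeded : ∀ n → fibVals k n ++ 1 ∷ [] ≡ seeded (suc n)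
  fibVals-seeded zero    rewrite take-[] {A = ℕ} k₀ = refl
  fibVals-seeded (suc n) =
    cong₂ _∷_ (trans (fib-window n) (cong (λ l → sum (take (k ∸ 1) l)) (fibVals-seeded n)))
              (fibVals-seeded n)

  fib-S : ∀ n → fib k n ≡ S n 1
  fib-S zero    = refl
  fib-S (suc n) = begin
    fib k (suc n)                                    ≡⟨ fib-window n ⟩
    sum (take (k ∸ 1) (fibVals k n ++ 1 ∷ []))       ≡⟨ cong (λ l → sum (take (k ∸ 1) l)) (fibVals-seeded n) ⟩
    sum (take (k ∸ 1) (seeded (suc n)))              ≡⟨ sym (S-closed (suc n) 1 1<k) ⟩
    S (suc n) 1                                      ∎

  formula : ∀ n → + 2 *ℤ + r k (suc n) ≡ + fib k n +ℤ d k (suc n)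
  formula n = begin
    + 2 *ℤ + r k (suc n)                                 ≡⟨ cong (λ t → + 2 *ℤ + t) (r-ways n) ⟩
    + 2 *ℤ + ways n false 1                              ≡⟨ twice-from-sum-and-difference (+ ways n true 1) (+ ways n false 1) ⟩
    (+ ways n true 1 +ℤ + ways n false 1) +ℤ - D n 1     ≡⟨ cong (_+ℤ - D n 1) (sym (pos-+ (ways n true 1) _)) ⟩
    + S n 1 +ℤ - D n 1                                   ≡⟨ cong₂ (λ s e → + s +ℤ - e) (sym (fib-S n)) (D-closed n 1 (s≤s z≤n) 1<k) ⟩
    + fib k n +ℤ - (δ n - δ (suc n))                     ≡⟨ cong (+ fib k n +ℤ_) (sym (swap-difference (δ n) _)) ⟩
    + fib k n +ℤ (δ (suc n) - δ n)                       ≡⟨ cong (+ fib k n +ℤ_) (sym (d-as-δ n)) ⟩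
    + fib k n +ℤ d k (suc n)                             ∎

open import Data.Integer using (+_; _+_; _*_)

proposition3p2 : (k : ℕ) → 3 ≤ k →
    (r k 0 ≡ 1) × ((n : ℕ) → + 2 * + (r k (suc n)) ≡ + fib k n + d k (suc n))
proposition3p2 (suc (suc k₀)) (s≤s (s≤s _)) = refl , Runs.formula k₀
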